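{- Let $G$ be a column continuous subgrid of $P_n\times P_n$ and $M$ a perfect matching of $G$. Then by applying a sequence of matching 2-switches one can convert $M$ into a perfect matching of $G$ which contains no $(i,j,k)$-bracket for any $i,j,k$.
   Context: The vertices of the grid $P_n\times P_n$ are labelled $(i,j)$, $1\le i,j\le n$ (row $i$, column $j$); $(i,j)$ and $(i',j')$ are adjacent iff $|i-i'|+|j-j'|=1$. An induced subgraph $G$ of the grid is a column continuous subgrid if whenever $(i_1,j),(i_2,j)\in V(G)$, then $(i,j)\in V(G)$ for all $i_1\le i\le i_2$. For $k\ge0$, an $(i,j,k)$-bracket in a perfect matching $M$ is a set of edges of $M$ of the form $\{\{(i,j),(i,j+1)\},\{(i+1,j),(i+2,j)\},\{(i+3,j),(i+4,j)\},\dots,\{(i+2k-1,j),(i+2k,j)\},\{(i+2k+1,j),(i+2k+1,j+1)\}\}$. A matching 2-switch: if $e_1=\{u_1,v_1\}$, $e_2=\{u_2,v_2\}\in M$ and $\{u_1,u_2\},\{v_1,v_2\}$ are edges of $G$, replace $e_1,e_2$ in $M$ by $\{u_1,u_2\},\{v_1,v_2\}$. -}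

module Defs where

open import Data.Nat using (ℕ; zero; suc; _+_; _*_; _∸_; _≤_; ∣_-_∣)
open import Data.Bool using (Bool; true; false)
open import Data.Product using (Σ; ∃; ∃-syntax; _×_; _,_)
open import Data.Sum using (_⊎_)
open import Relation.Nullary using (¬_)
open import Relation.Binary.PropositionalEquality using (_≡_)
open import Function.Bundles using (_⇔_)
open import Relation.Binary.Construct.Closure.ReflexiveTransitive using (Star)

-- A vertex (i , j) : row i, column j.
Vertex : Set
Vertex = ℕ × ℕ

Adj : Vertex → Vertex → Set
Adj (i , j) (i' , j') = ∣ i - i' ∣ + ∣ j - j' ∣ ≡ 1

VSet : Set
VSet = Vertex → Bool

InGrid : ℕ → VSet → Set
InGrid n V = ∀ i j → V (i , j) ≡ true → (1 ≤ i × i ≤ n) × (1 ≤ j × j ≤ n)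

ColumnContinuous : VSet → Set
ColumnContinuous V = ∀ i₁ i₂ i j → V (i₁ , j) ≡ true → V (i₂ , j) ≡ true →
  i₁ ≤ i → i ≤ i₂ → V (i , j) ≡ true

-- G is a column continuous subgrid of P_n × P_n (the induced subgraph on V).
ColumnContinuousSubgrid : ℕ → VSet → Set
ColumnContinuousSubgrid n V = InGrid n V × ColumnContinuous V

EdgeG : VSet → Vertex → Vertex → Set
EdgeG V u v = V u ≡ true × V v ≡ true × Adj u v

-- A set of edges, represented as a (Boolean) relation on vertices;
-- the unordered edge {u,v} is in M iff M u v ≡ true (and M is symmetric).
EdgeRel : Set
EdgeRel = Vertex → Vertex → Bool

PerfectMatching : VSet → EdgeRel → Set
PerfectMatching V M =
  (∀ u v → M u v ≡ true → M v u ≡ true) ×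
  (∀ u v → M u v ≡ true → EdgeG V u v) ×
  (∀ u → V u ≡ true → ∃[ v ] (M u v ≡ true × (∀ w → M u w ≡ true → w ≡ v)))

SameEdge : Vertex → Vertex → Vertex → Vertex → Set
SameEdge x y a b = (x ≡ a × y ≡ b) ⊎ (x ≡ b × y ≡ a)

Switch2 : VSet → EdgeRel → EdgeRel → Set
Switch2 V M M' = ∃[ u₁ ] ∃[ v₁ ] ∃[ u₂ ] ∃[ v₂ ]
  (M u₁ v₁ ≡ true × M u₂ v₂ ≡ true × EdgeG V u₁ u₂ × EdgeG V v₁ v₂ ×
   (∀ x y → (M' x y ≡ true) ⇔
      ((M x y ≡ true × ¬ SameEdge x y u₁ v₁ × ¬ SameEdge x y u₂ v₂)
       ⊎ SameEdge x y u₁ u₂ ⊎ SameEdge x y v₁ v₂)))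

Switches : VSet → EdgeRel → EdgeRel → Set
Switches V = Star (Switch2 V)

HasBracket : EdgeRel → ℕ → ℕ → ℕ → Set
HasBracket M i j k =
  M (i , j) (i , suc j) ≡ true ×
  (∀ t → 1 ≤ t → t ≤ k → M (i + (2 * t ∸ 1) , j) (i + 2 * t , j) ≡ true) ×
  M (i + 2 * k + 1 , j) (i + 2 * k + 1 , suc j) ≡ true

BracketFree : EdgeRel → Set
BracketFree M = ∀ i j k → ¬ HasBracket M i j k

-- Weight each horizontal edge {(r,c),(r,c+1)} of a perfect matching by n + 1 − r and let Φ be the
-- total weight. If an (i,j,k)-bracket is present, one or two 2-switches on unit squares lower Φ.
-- For k = 0 the two horizontal edges of the bracket are switched to vertical ones. Otherwise look at
-- the partner of (i+1,j+1). If it is (i+2,j+1), switching the square below the top edge to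
-- horizontal and then the square of the top edge to vertical trades the top edge for a horizontal
-- edge two rows lower. If it is (i+1,j+2), column continuity lets us follow vertical edges down
-- column j+1 until a horizontal edge closes them off, which yields an (i+1,j+1,m)-bracket with
-- m < k, reduced recursively. All brackets lie in a bounded range, so their presence is decidable,
-- and switching while Φ decreases ends in a bracket-free perfect matching.
module Submission where

open import Data.Bool using (Bool; true; false; if_then_else_)
import Data.Bool as Bool
open import Data.Bool.Properties using (¬-not; ⇔→≡)
open import Data.Empty using (⊥-elim)
open import Data.Nat using (ℕ; zero; suc; _+_; _*_; _∸_; _≤_; _<_; z≤n; s≤s; s≤s⁻¹; z<s; s<s; ∣_-_∣; _≟_)
open import Data.Nat.Induction using (<-rec)
open import Data.Nat.Properties
open import Algebra.Properties.CommutativeSemigroup +-commutativeSemigroup using (xy∙z≈xz∙y; x∙yz≈xz∙y)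
open import Data.Product using (∃; ∃-syntax; Σ-syntax; _×_; _,_; proj₁; proj₂)
open import Data.Product.Properties using (≡-dec)
open import Data.Sum using (_⊎_; inj₁; inj₂; [_,_]′)
open import Function using (_∘_)
open import Function.Bundles using (_⇔_; mk⇔; Equivalence)
open import Relation.Binary.Construct.Closure.ReflexiveTransitive using (ε; _◅_; _◅◅_)
open import Relation.Binary.Definitions using (DecidableEquality)
open import Relation.Binary.PropositionalEquality
open import Relation.Nullary using (¬_; Dec; yes; no; does)
open import Relation.Nullary.Decidable using (_×-dec_; _⊎-dec_; ¬?; dec-true; dec-false)

open import Defs

open Equivalence using (to; from)
open ≡-Reasoning

_≟ᵥ_ : DecidableEquality Vertex
_≟ᵥ_ = ≡-dec _≟_ _≟_

≢-row : ∀ {a b c d : ℕ} → a < b → (a , c) ≢ (b , d)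
≢-row a<b eq = <⇒≢ a<b (cong proj₁ eq)

≢-col : ∀ {a b c d : ℕ} → c < d → (a , c) ≢ (b , d)
≢-col c<d eq = <⇒≢ c<d (cong proj₂ eq)

data Neighbour : Vertex → Vertex → Set where
  below : ∀ {a b} → Neighbour (a , b) (suc a , b)
  above : ∀ {a b} → Neighbour (suc a , b) (a , b)
  right : ∀ {a b} → Neighbour (a , b) (a , suc b)
  left  : ∀ {a b} → Neighbour (a , suc b) (a , b)

∣m-n∣≡1⇒n≡1+m⊎m≡1+n : ∀ m n → ∣ m - n ∣ ≡ 1 → n ≡ suc m ⊎ m ≡ suc n
∣m-n∣≡1⇒n≡1+m⊎m≡1+n zero    n       eq = inj₁ eq
∣m-n∣≡1⇒n≡1+m⊎m≡1+n (suc m) zero    eq = inj₂ eq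
∣m-n∣≡1⇒n≡1+m⊎m≡1+n (suc m) (suc n) eq with ∣m-n∣≡1⇒n≡1+m⊎m≡1+n m n eq
... | inj₁ n≡1+m = inj₁ (cong suc n≡1+m)
... | inj₂ m≡1+n = inj₂ (cong suc m≡1+n)

∣n-1+n∣≡1 : ∀ n → ∣ n - suc n ∣ ≡ 1
∣n-1+n∣≡1 zero    = refl
∣n-1+n∣≡1 (suc n) = ∣n-1+n∣≡1 n

adj-sym : ∀ {u v} → Adj u v → Adj v u
adj-sym {a , b} {c , d} adj = trans (cong₂ _+_ (∣-∣-comm c a) (∣-∣-comm d b)) adj

adj⇒neighbour : ∀ {u v} → Adj u v → Neighbour u v
adj⇒neighbour {a , b} {c , d} adj with ∣ a - c ∣ in rows | ∣ b - d ∣ in cols | adj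
... | 0 | 0 | ()
... | 0 | suc (suc _) | ()
... | 1 | suc _ | ()
... | suc (suc _) | _ | ()
... | 0 | 1 | _ with ∣m-n∣≡0⇒m≡n {a} {c} rows | ∣m-n∣≡1⇒n≡1+m⊎m≡1+n b d cols
...   | refl | inj₁ refl = right
...   | refl | inj₂ refl = left
adj⇒neighbour {a , b} {c , d} _ | 1 | 0 | _ with ∣m-n∣≡0⇒m≡n {b} {d} cols | ∣m-n∣≡1⇒n≡1+m⊎m≡1+n a c rows
...   | refl | inj₁ refl = below
...   | refl | inj₂ refl = above

neighbour⇒adj : ∀ {u v} → Neighbour u v → Adj u v
neighbour⇒adj (below {a} {b}) = cong₂ _+_ (∣n-1+n∣≡1 a) (∣n-n∣≡0 b)
neighbour⇒adj (right {a} {b}) = cong₂ _+_ (∣n-n∣≡0 a) (∣n-1+n∣≡1 b)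
neighbour⇒adj (above {a} {b}) = adj-sym {a , b} {suc a , b} (neighbour⇒adj (below {a} {b}))
neighbour⇒adj (left {a} {b})  = adj-sym {a , b} {a , suc b} (neighbour⇒adj (right {a} {b}))

neighbour⇒≢ : ∀ {u v} → Neighbour u v → u ≢ v
neighbour⇒≢ below = ≢-row (n<1+n _)
neighbour⇒≢ above = ≢-sym (≢-row (n<1+n _))
neighbour⇒≢ right = ≢-col (n<1+n _)
neighbour⇒≢ left  = ≢-sym (≢-col (n<1+n _))

hor : EdgeRel → Vertex → Bool
hor M (a , b) = M (a , b) (a , suc b)

Horizontal : EdgeRel → Vertex → Set
Horizontal M u = hor M u ≡ true

Vertical : EdgeRel → Vertex → Set
Vertical M (a , b) = M (a , b) (suc a , b) ≡ true

sameEdge? : ∀ x y a b → Dec (SameEdge x y a b)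
sameEdge? x y a b = (x ≟ᵥ a ×-dec y ≟ᵥ b) ⊎-dec (x ≟ᵥ b ×-dec y ≟ᵥ a)

sameEdge-sym : ∀ {x y a b} → SameEdge x y a b → SameEdge y x a b
sameEdge-sym (inj₁ (x≡a , y≡b)) = inj₂ (y≡b , x≡a)
sameEdge-sym (inj₂ (x≡b , y≡a)) = inj₁ (y≡a , x≡b)

sameEdge-flip : ∀ {x y a b} → SameEdge x y a b → SameEdge x y b a
sameEdge-flip (inj₁ same) = inj₂ same
sameEdge-flip (inj₂ same) = inj₁ same

sameEdge-edge : ∀ {V x y a b} → SameEdge x y a b → EdgeG V a b → EdgeG V x y
sameEdge-edge (inj₁ (refl , refl)) e = e
sameEdge-edge {a = a} {b} (inj₂ (refl , refl)) (a∈V , b∈V , adj) = b∈V , a∈V , adj-sym {a} {b} adj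

horizontal≢vertical : ∀ {p q a b c} → ¬ SameEdge (p , q) (p , suc q) (a , c) (b , c)
horizontal≢vertical (inj₁ (refl , eq)) = ≢-col (n<1+n _) (sym eq)
horizontal≢vertical (inj₂ (refl , eq)) = ≢-col (n<1+n _) (sym eq)

sameHorizontal⇒≡ : ∀ {p q a c} → SameEdge (p , q) (p , suc q) (a , c) (a , suc c) → (p , q) ≡ (a , c)
sameHorizontal⇒≡ (inj₁ (eq , _))    = eq
sameHorizontal⇒≡ (inj₂ (refl , eq)) = ⊥-elim (≢-col (m<n⇒m<1+n (n<1+n _)) (sym eq))

SwitchedEdge : EdgeRel → (u₁ v₁ u₂ v₂ x y : Vertex) → Set
SwitchedEdge M u₁ v₁ u₂ v₂ x y =
  (M x y ≡ true × ¬ SameEdge x y u₁ v₁ × ¬ SameEdge x y u₂ v₂) ⊎ SameEdge x y u₁ u₂ ⊎ SameEdge x y v₁ v₂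

switchedEdge? : ∀ M u₁ v₁ u₂ v₂ x y → Dec (SwitchedEdge M u₁ v₁ u₂ v₂ x y)
switchedEdge? M u₁ v₁ u₂ v₂ x y =
  (M x y Bool.≟ true ×-dec ¬? (sameEdge? x y u₁ v₁) ×-dec ¬? (sameEdge? x y u₂ v₂))
  ⊎-dec sameEdge? x y u₁ u₂ ⊎-dec sameEdge? x y v₁ v₂

IsSwitch : EdgeRel → (u₁ v₁ u₂ v₂ : Vertex) → EdgeRel → Set
IsSwitch M u₁ v₁ u₂ v₂ M' = ∀ x y → (M' x y ≡ true) ⇔ SwitchedEdge M u₁ v₁ u₂ v₂ x y

switch : EdgeRel → (u₁ v₁ u₂ v₂ : Vertex) → EdgeRel
switch M u₁ v₁ u₂ v₂ x y = does (switchedEdge? M u₁ v₁ u₂ v₂ x y)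

does≡true⇔ : ∀ {A : Set} (a? : Dec A) → (does a? ≡ true) ⇔ A
does≡true⇔ (yes a)  = mk⇔ (λ _ → a) (λ _ → refl)
does≡true⇔ (no ¬a) = mk⇔ (λ ()) (⊥-elim ∘ ¬a)

switch-isSwitch : ∀ M u₁ v₁ u₂ v₂ → IsSwitch M u₁ v₁ u₂ v₂ (switch M u₁ v₁ u₂ v₂)
switch-isSwitch M u₁ v₁ u₂ v₂ x y = does≡true⇔ (switchedEdge? M u₁ v₁ u₂ v₂ x y)

switch-step : ∀ {V M u₁ v₁ u₂ v₂} → M u₁ v₁ ≡ true → M u₂ v₂ ≡ true →
  EdgeG V u₁ u₂ → EdgeG V v₁ v₂ → Switch2 V M (switch M u₁ v₁ u₂ v₂)
switch-step {M = M} {u₁} {v₁} {u₂} {v₂} m₁ m₂ e₁ e₂ =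
  u₁ , v₁ , u₂ , v₂ , m₁ , m₂ , e₁ , e₂ , switch-isSwitch M u₁ v₁ u₂ v₂

switchedEdge-swap : ∀ {M u₁ v₁ u₂ v₂ x y} →
  SwitchedEdge M u₁ v₁ u₂ v₂ x y → SwitchedEdge M u₂ v₂ u₁ v₁ x y
switchedEdge-swap (inj₁ (m , n₁ , n₂))  = inj₁ (m , n₂ , n₁)
switchedEdge-swap (inj₂ (inj₁ same)) = inj₂ (inj₁ (sameEdge-flip same))
switchedEdge-swap (inj₂ (inj₂ same)) = inj₂ (inj₂ (sameEdge-flip same))

switchedEdge-flip : ∀ {M u₁ v₁ u₂ v₂ x y} →
  SwitchedEdge M u₁ v₁ u₂ v₂ x y → SwitchedEdge M v₁ u₁ v₂ u₂ x y
switchedEdge-flip (inj₁ (m , n₁ , n₂))  = inj₁ (m , n₁ ∘ sameEdge-flip , n₂ ∘ sameEdge-flip)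
switchedEdge-flip (inj₂ (inj₁ same)) = inj₂ (inj₂ same)
switchedEdge-flip (inj₂ (inj₂ same)) = inj₂ (inj₁ same)

switchedEdge-sym : ∀ {M u₁ v₁ u₂ v₂ x y} → (∀ u v → M u v ≡ true → M v u ≡ true) →
  SwitchedEdge M u₁ v₁ u₂ v₂ x y → SwitchedEdge M u₁ v₁ u₂ v₂ y x
switchedEdge-sym sym-M (inj₁ (m , n₁ , n₂)) =
  inj₁ (sym-M _ _ m , n₁ ∘ sameEdge-sym , n₂ ∘ sameEdge-sym)
switchedEdge-sym _ (inj₂ (inj₁ same)) = inj₂ (inj₁ (sameEdge-sym same))
switchedEdge-sym _ (inj₂ (inj₂ same)) = inj₂ (inj₂ (sameEdge-sym same))

isSwitch-swap : ∀ {M u₁ v₁ u₂ v₂ M'} → IsSwitch M u₁ v₁ u₂ v₂ M' → IsSwitch M u₂ v₂ u₁ v₁ M'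
isSwitch-swap {M} {u₁} {v₁} {u₂} {v₂} s x y =
  mk⇔ (switchedEdge-swap {M} {u₁} {v₁} {u₂} {v₂} ∘ to (s x y))
      (from (s x y) ∘ switchedEdge-swap {M} {u₂} {v₂} {u₁} {v₁})

isSwitch-flip : ∀ {M u₁ v₁ u₂ v₂ M'} → IsSwitch M u₁ v₁ u₂ v₂ M' → IsSwitch M v₁ u₁ v₂ u₂ M'
isSwitch-flip {M} {u₁} {v₁} {u₂} {v₂} s x y =
  mk⇔ (switchedEdge-flip {M} {u₁} {v₁} {u₂} {v₂} ∘ to (s x y))
      (from (s x y) ∘ switchedEdge-flip {M} {v₁} {u₁} {v₂} {u₂})

isSwitch-unchanged : ∀ {M u₁ v₁ u₂ v₂ M' x y} → IsSwitch M u₁ v₁ u₂ v₂ M' →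
  ¬ SameEdge x y u₁ v₁ → ¬ SameEdge x y u₂ v₂ → ¬ SameEdge x y u₁ u₂ → ¬ SameEdge x y v₁ v₂ →
  M' x y ≡ M x y
isSwitch-unchanged {x = x} {y} s n₁ n₂ n₃ n₄ = ⇔→≡ (mk⇔
  ([ proj₁ , [ ⊥-elim ∘ n₃ , ⊥-elim ∘ n₄ ]′ ]′ ∘ to (s x y))
  (λ m → from (s x y) (inj₁ (m , n₁ , n₂))))

isSwitch-removed : ∀ {M u₁ v₁ u₂ v₂ M' x y} → IsSwitch M u₁ v₁ u₂ v₂ M' →
  SameEdge x y u₁ v₁ → ¬ SameEdge x y u₁ u₂ → ¬ SameEdge x y v₁ v₂ → M' x y ≡ false
isSwitch-removed {x = x} {y} s same n₃ n₄ =
  ¬-not ([ (λ (_ , n₁ , _) → n₁ same) , [ n₃ , n₄ ]′ ]′ ∘ to (s x y))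

module PerfectMatchingProperties {V : VSet} {M : EdgeRel} (pm : PerfectMatching V M) where

  symmetric : ∀ {u v} → M u v ≡ true → M v u ≡ true
  symmetric = proj₁ pm _ _

  edge : ∀ {u v} → M u v ≡ true → EdgeG V u v
  edge = proj₁ (proj₂ pm) _ _

  matched-inV : ∀ {u v} → M u v ≡ true → V u ≡ true
  matched-inV = proj₁ ∘ edge

  neighbour : ∀ {u v} → M u v ≡ true → Neighbour u v
  neighbour = adj⇒neighbour ∘ proj₂ ∘ proj₂ ∘ edge

  partner : ∀ {u} → V u ≡ true → ∃[ v ] M u v ≡ true
  partner u∈V = let (v , m , _) = proj₂ (proj₂ pm) _ u∈V in v , m

  partner-unique : ∀ {u v w} → M u v ≡ true → M u w ≡ true → v ≡ w
  partner-unique m m' =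
    let (_ , _ , unique) = proj₂ (proj₂ pm) _ (matched-inV m) in trans (unique _ m) (sym (unique _ m'))

  not-horizontal : ∀ {a b v} → M (a , b) v ≡ true → v ≢ (a , suc b) → hor M (a , b) ≡ false
  not-horizontal m v≢right = ¬-not (v≢right ∘ partner-unique m)

switched-partner : ∀ {V M u₁ v₁ u₂ v₂ M'} → PerfectMatching V M → IsSwitch M u₁ v₁ u₂ v₂ M' →
  M u₁ v₁ ≡ true → u₁ ≢ v₁ → u₁ ≢ v₂ → M' u₁ u₂ ≡ true × (∀ w → M' u₁ w ≡ true → w ≡ u₂)
switched-partner {u₁ = u₁} {v₁} {u₂} {v₂} {M'} pm s m u₁≢v₁ u₁≢v₂ =
  from (s u₁ u₂) (inj₂ (inj₁ (inj₁ (refl , refl)))) , only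
  where
  open PerfectMatchingProperties pm
  only : ∀ w → M' u₁ w ≡ true → w ≡ u₂
  only w m' with to (s u₁ w) m'
  ... | inj₁ (m″ , not-old , _)             = ⊥-elim (not-old (inj₁ (refl , partner-unique m″ m)))
  ... | inj₂ (inj₁ (inj₁ (_ , w≡u₂)))        = w≡u₂
  ... | inj₂ (inj₁ (inj₂ (u₁≡u₂ , w≡u₁)))    = trans w≡u₁ u₁≡u₂
  ... | inj₂ (inj₂ (inj₁ (u₁≡v₁ , _)))       = ⊥-elim (u₁≢v₁ u₁≡v₁)
  ... | inj₂ (inj₂ (inj₂ (u₁≡v₂ , _)))       = ⊥-elim (u₁≢v₂ u₁≡v₂)

-- u₁ ≢ v₂ and v₁ ≢ u₂ rule out the degenerate switch whose two new edges coincide.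
isSwitch-perfect : ∀ {V M u₁ v₁ u₂ v₂ M'} → PerfectMatching V M →
  M u₁ v₁ ≡ true → M u₂ v₂ ≡ true → EdgeG V u₁ u₂ → EdgeG V v₁ v₂ → u₁ ≢ v₂ → v₁ ≢ u₂ →
  IsSwitch M u₁ v₁ u₂ v₂ M' → PerfectMatching V M'
isSwitch-perfect {V} {M} {u₁} {v₁} {u₂} {v₂} {M'} pm m₁ m₂ e₁ e₂ u₁≢v₂ v₁≢u₂ s =
  (λ u v m' → from (s v u) (switchedEdge-sym (proj₁ pm) (to (s u v) m'))) , edge′ , partner′
  where
  open PerfectMatchingProperties pm
  u₁≢v₁ : u₁ ≢ v₁
  u₁≢v₁ = neighbour⇒≢ (neighbour m₁)
  u₂≢v₂ : u₂ ≢ v₂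
  u₂≢v₂ = neighbour⇒≢ (neighbour m₂)
  edge′ : ∀ u v → M' u v ≡ true → EdgeG V u v
  edge′ u v m' with to (s u v) m'
  ... | inj₁ (m , _)      = edge m
  ... | inj₂ (inj₁ same) = sameEdge-edge same e₁
  ... | inj₂ (inj₂ same) = sameEdge-edge same e₂
  partner′ : ∀ u → V u ≡ true → ∃[ v ] (M' u v ≡ true × (∀ w → M' u w ≡ true → w ≡ v))
  partner′ u u∈V with u ≟ᵥ u₁ | u ≟ᵥ v₁ | u ≟ᵥ u₂ | u ≟ᵥ v₂
  ... | yes refl | _ | _ | _ = u₂ , switched-partner pm s m₁ u₁≢v₁ u₁≢v₂
  ... | no _ | yes refl | _ | _ =
    v₂ , switched-partner pm (isSwitch-flip s) (symmetric m₁) (≢-sym u₁≢v₁) v₁≢u₂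
  ... | no _ | no _ | yes refl | _ =
    u₁ , switched-partner pm (isSwitch-swap s) m₂ u₂≢v₂ (≢-sym v₁≢u₂)
  ... | no _ | no _ | no _ | yes refl =
    v₁ , switched-partner pm (isSwitch-flip (isSwitch-swap s)) (symmetric m₂) (≢-sym u₂≢v₂) (≢-sym u₁≢v₂)
  ... | no ≢u₁ | no ≢v₁ | no ≢u₂ | no ≢v₂ with partner u∈V
  ...   | p , m = p , from (s u p) (inj₁ (m , untouched₁ , untouched₂)) , only
    where
    untouched₁ : ¬ SameEdge u p u₁ v₁
    untouched₁ = [ ≢u₁ ∘ proj₁ , ≢v₁ ∘ proj₁ ]′
    untouched₂ : ¬ SameEdge u p u₂ v₂
    untouched₂ = [ ≢u₂ ∘ proj₁ , ≢v₂ ∘ proj₁ ]′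
    only : ∀ w → M' u w ≡ true → w ≡ p
    only w m' with to (s u w) m'
    ... | inj₁ (m″ , _)     = partner-unique m″ m
    ... | inj₂ (inj₁ same) = ⊥-elim ([ ≢u₁ ∘ proj₁ , ≢u₂ ∘ proj₁ ]′ same)
    ... | inj₂ (inj₂ same) = ⊥-elim ([ ≢v₁ ∘ proj₁ , ≢v₂ ∘ proj₁ ]′ same)

InRange : ℕ → Vertex → Set
InRange N (p , q) = p < N × q < N

sumTo : ℕ → (ℕ → ℕ) → ℕ
sumTo zero    f = 0
sumTo (suc N) f = sumTo N f + f N

sumTo-cong : ∀ N {f g : ℕ → ℕ} → (∀ x → x < N → f x ≡ g x) → sumTo N f ≡ sumTo N g
sumTo-cong zero    _  = refl
sumTo-cong (suc N) eq = cong₂ _+_ (sumTo-cong N (λ x x<N → eq x (m<n⇒m<1+n x<N))) (eq N (n<1+n N))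

sumTo-update : ∀ N {f g : ℕ → ℕ} {p} → p < N → (∀ x → x ≢ p → f x ≡ g x) →
  sumTo N f + g p ≡ sumTo N g + f p
sumTo-update (suc N) {f} {g} {p} p<1+N agree with N ≟ p
... | yes refl = begin
  sumTo N f + f N + g N  ≡⟨ cong (λ s → s + f N + g N) (sumTo-cong N (λ x x<N → agree x (<⇒≢ x<N))) ⟩
  sumTo N g + f N + g N  ≡⟨ xy∙z≈xz∙y (sumTo N g) (f N) (g N) ⟩
  sumTo N g + g N + f N  ∎
... | no N≢p = begin
  sumTo N f + f N + g p  ≡⟨ xy∙z≈xz∙y (sumTo N f) (f N) (g p) ⟩
  sumTo N f + g p + f N  ≡⟨ cong₂ _+_ (sumTo-update N p<N agree) (agree N N≢p) ⟩
  sumTo N g + f p + g N  ≡⟨ xy∙z≈xz∙y (sumTo N g) (f p) (g N) ⟩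
  sumTo N g + g N + f p  ∎
  where p<N = ≤∧≢⇒< (s≤s⁻¹ p<1+N) (≢-sym N≢p)

sumGrid : ℕ → (Vertex → ℕ) → ℕ
sumGrid N F = sumTo N (λ a → sumTo N (λ b → F (a , b)))

sumGrid-update : ∀ N {F G : Vertex → ℕ} {v} → InRange N v → (∀ u → u ≢ v → F u ≡ G u) →
  sumGrid N F + G v ≡ sumGrid N G + F v
sumGrid-update N {F} {G} {p , q} (p<N , q<N) agree = +-cancelʳ-≡ (row G p) _ _ (begin
    sumGrid N F + G (p , q) + row G p    ≡⟨ xy∙z≈xz∙y (sumGrid N F) (G (p , q)) (row G p) ⟩
    sumGrid N F + row G p + G (p , q)    ≡⟨ cong (_+ G (p , q)) rows ⟩
    sumGrid N G + row F p + G (p , q)    ≡⟨ +-assoc (sumGrid N G) (row F p) (G (p , q)) ⟩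
    sumGrid N G + (row F p + G (p , q))  ≡⟨ cong (sumGrid N G +_) within-row ⟩
    sumGrid N G + (row G p + F (p , q))  ≡⟨ x∙yz≈xz∙y (sumGrid N G) (row G p) (F (p , q)) ⟩
    sumGrid N G + F (p , q) + row G p    ∎)
  where
  row : (Vertex → ℕ) → ℕ → ℕ
  row H a = sumTo N (λ b → H (a , b))
  rows : sumGrid N F + row G p ≡ sumGrid N G + row F p
  rows = sumTo-update N p<N (λ a a≢p → sumTo-cong N (λ b _ → agree (a , b) (a≢p ∘ cong proj₁)))
  within-row : row F p + G (p , q) ≡ row G p + F (p , q)
  within-row = sumTo-update N q<N (λ b b≢q → agree (p , b) (b≢q ∘ cong proj₂))

sumGrid-update₂ : ∀ N {F G : Vertex → ℕ} {v w} → InRange N v → InRange N w → v ≢ w →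
  (∀ u → u ≢ v → u ≢ w → F u ≡ G u) → sumGrid N F + (G v + G w) ≡ sumGrid N G + (F v + F w)
sumGrid-update₂ N {F} {G} {v} {w} v∈ w∈ v≢w agree = begin
    sumGrid N F + (G v + G w)  ≡⟨ +-assoc (sumGrid N F) (G v) (G w) ⟨
    sumGrid N F + G v + G w    ≡⟨ cong (λ x → sumGrid N F + x + G w) H-at-v ⟨
    sumGrid N F + H v + G w    ≡⟨ cong (_+ G w) (sumGrid-update N v∈ F≈H) ⟩
    sumGrid N H + F v + G w    ≡⟨ xy∙z≈xz∙y (sumGrid N H) (F v) (G w) ⟩
    sumGrid N H + G w + F v    ≡⟨ cong (_+ F v) (sumGrid-update N w∈ H≈G) ⟩
    sumGrid N G + H w + F v    ≡⟨ cong (λ x → sumGrid N G + x + F v) H-at-w ⟩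
    sumGrid N G + F w + F v    ≡⟨ +-assoc (sumGrid N G) (F w) (F v) ⟩
    sumGrid N G + (F w + F v)  ≡⟨ cong (sumGrid N G +_) (+-comm (F w) (F v)) ⟩
    sumGrid N G + (F v + F w)  ∎
  where
  H : Vertex → ℕ
  H u = if does (u ≟ᵥ v) then G v else F u
  H-at-v : H v ≡ G v
  H-at-v = cong (λ b → if b then G v else F v) (dec-true (v ≟ᵥ v) refl)
  H-at-w : H w ≡ F w
  H-at-w = cong (λ b → if b then G v else F w) (dec-false (w ≟ᵥ v) (≢-sym v≢w))
  F≈H : ∀ u → u ≢ v → F u ≡ H u
  F≈H u u≢v = sym (cong (λ b → if b then G v else F u) (dec-false (u ≟ᵥ v) u≢v))
  H≈G : ∀ u → u ≢ w → H u ≡ G u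
  H≈G u u≢w with u ≟ᵥ v
  ... | yes refl = refl
  ... | no u≢v   = agree u u≢v u≢w

m+n≡o+p⇒p<n⇒m<o : ∀ {m n o p} → m + n ≡ o + p → p < n → m < o
m+n≡o+p⇒p<n⇒m<o {m} {n} {o} eq p<n = +-cancelʳ-< n m o (subst (_< o + n) (sym eq) (+-monoʳ-< o p<n))

Ladder : EdgeRel → ℕ → ℕ → ℕ → Set
Ladder M r c zero    = Horizontal M (r , c)
Ladder M r c (suc k) = Vertical M (r , c) × Ladder M (suc (suc r)) c k

Bracket : EdgeRel → ℕ → ℕ → ℕ → Set
Bracket M i j k = Horizontal M (i , j) × Ladder M (suc i) j k

ladder? : ∀ M r c k → Dec (Ladder M r c k)
ladder? M r c zero    = hor M (r , c) Bool.≟ true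
ladder? M r c (suc k) = M (r , c) (suc r , c) Bool.≟ true ×-dec ladder? M (suc (suc r)) c k

bracket? : ∀ M i j k → Dec (Bracket M i j k)
bracket? M i j k = hor M (i , j) Bool.≟ true ×-dec ladder? M (suc i) j k

ladder-bottom : ∀ {M r c} k → Ladder M r c k → ∃[ b ] (r ≤ b × Horizontal M (b , c))
ladder-bottom zero    bottom       = _ , ≤-refl , bottom
ladder-bottom (suc k) (_ , ladder) =
  let (b , r+2≤b , bottom) = ladder-bottom k ladder in b , ≤-trans (m≤n+m _ 2) r+2≤b , bottom

-- 2 * suc n ∸ 1 reduces definitionally to n + suc (n + 0).
m+[2*[1+n]∸1]≡1+m+2*n : ∀ m n → m + (2 * suc n ∸ 1) ≡ suc (m + 2 * n)
m+[2*[1+n]∸1]≡1+m+2*n m n = trans (cong (m +_) (+-suc n (n + 0))) (+-suc m (2 * n))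

m+2*[1+n]≡2+m+2*n : ∀ m n → m + 2 * suc n ≡ suc (suc (m + 2 * n))
m+2*[1+n]≡2+m+2*n m n = trans (+-suc m _) (cong suc (m+[2*[1+n]∸1]≡1+m+2*n m n))

ladder-intro : ∀ {M c} k r → (∀ s → s < k → Vertical M (r + 2 * s , c)) →
  Horizontal M (r + 2 * k , c) → Ladder M r c k
ladder-intro {M} {c} zero    r _ bottom = subst (λ x → Horizontal M (x , c)) (+-identityʳ r) bottom
ladder-intro {M} {c} (suc k) r verticals bottom =
  subst (λ x → Vertical M (x , c)) (+-identityʳ r) (verticals 0 z<s) ,
  ladder-intro k (suc (suc r))
    (λ s s<k → subst (λ x → Vertical M (x , c)) (m+2*[1+n]≡2+m+2*n r s) (verticals (suc s) (s<s s<k)))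
    (subst (λ x → Horizontal M (x , c)) (m+2*[1+n]≡2+m+2*n r k) bottom)

hasBracket⇒bracket : ∀ {M i j k} → HasBracket M i j k → Bracket M i j k
hasBracket⇒bracket {M} {i} {j} {k} (top , verticals , bottom) =
  top ,
  ladder-intro k (suc i)
    (λ s s<k → subst₂ (λ x y → M (x , j) (y , j) ≡ true)
                 (m+[2*[1+n]∸1]≡1+m+2*n i s) (m+2*[1+n]≡2+m+2*n i s) (verticals (suc s) (s≤s z≤n) s<k))
    (subst (λ x → Horizontal M (x , j)) (+-comm _ 1) bottom)

module Normalisation (n : ℕ) (V : VSet) (inGrid : InGrid n V) (columnContinuous : ColumnContinuous V)
  where

  weight : ℕ → ℕ
  weight r = suc (n ∸ r)

  weight-decreasing : ∀ {r s} → r < s → s ≤ n → weight s < weight r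
  weight-decreasing r<s s≤n = s≤s (∸-monoʳ-< r<s s≤n)

  horWeight : EdgeRel → Vertex → ℕ
  horWeight M (a , b) = if hor M (a , b) then weight a else 0

  horWeight-true : ∀ {M a b} → Horizontal M (a , b) → horWeight M (a , b) ≡ weight a
  horWeight-true {a = a} = cong (λ h → if h then weight a else 0)

  horWeight-false : ∀ {M a b} → hor M (a , b) ≡ false → horWeight M (a , b) ≡ 0
  horWeight-false {a = a} = cong (λ h → if h then weight a else 0)

  Φ : EdgeRel → ℕ
  Φ M = sumGrid (suc n) (horWeight M)

  inRange : ∀ {u} → V u ≡ true → InRange (suc n) u
  inRange {p , q} u∈V = let ((_ , p≤n) , (_ , q≤n)) = inGrid p q u∈V in s≤s p≤n , s≤s q≤n

  Φ-update₂ : ∀ {M M' v w} → V v ≡ true → V w ≡ true → v ≢ w →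
    (∀ u → u ≢ v → u ≢ w → hor M' u ≡ hor M u) →
    Φ M' + (horWeight M v + horWeight M w) ≡ Φ M + (horWeight M' v + horWeight M' w)
  Φ-update₂ v∈V w∈V v≢w same = sumGrid-update₂ (suc n) (inRange v∈V) (inRange w∈V) v≢w
    λ { (p , q) u≢v u≢w → cong (λ h → if h then weight p else 0) (same (p , q) u≢v u≢w) }

  record SquareSwitch (M : EdgeRel) (r j : ℕ) : Set where
    field
      switched      : EdgeRel
      step          : Switch2 V M switched
      perfect       : PerfectMatching V switched
      hor-elsewhere : ∀ u → u ≢ (r , j) → u ≢ (suc r , j) → hor switched u ≡ hor M u

  open SquareSwitch

  verticalise : ∀ {M r j} → PerfectMatching V M → Horizontal M (r , j) → Horizontal M (suc r , j) →
    Σ[ s ∈ SquareSwitch M r j ] Φ (switched s) + (weight r + weight (suc r)) ≡ Φ M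
  verticalise {M} {r} {j} pm top bottom = s , (begin
      Φ M' + (weight r + weight (suc r))
        ≡⟨ cong₂ (λ x y → Φ M' + (x + y)) (horWeight-true {M} top) (horWeight-true {M} bottom) ⟨
      Φ M' + (horWeight M (r , j) + horWeight M (suc r , j))
        ≡⟨ Φ-update₂ {M} {M'} (matched-inV top) (matched-inV bottom) (≢-row (n<1+n r))
                     (hor-elsewhere s) ⟩
      Φ M + (horWeight M' (r , j) + horWeight M' (suc r , j))
        ≡⟨ cong₂ (λ x y → Φ M + (x + y))
                 (horWeight-false {M'} removed-top) (horWeight-false {M'} removed-bottom) ⟩
      Φ M + 0
        ≡⟨ +-identityʳ _ ⟩
      Φ M ∎)
    where
    open PerfectMatchingProperties pm
    M' : EdgeRel
    M' = switch M (r , j) (r , suc j) (suc r , j) (suc r , suc j)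
    isSwitch : IsSwitch M (r , j) (r , suc j) (suc r , j) (suc r , suc j) M'
    isSwitch = switch-isSwitch M _ _ _ _
    removed-top : hor M' (r , j) ≡ false
    removed-top = isSwitch-removed isSwitch (inj₁ (refl , refl)) horizontal≢vertical horizontal≢vertical
    removed-bottom : hor M' (suc r , j) ≡ false
    removed-bottom =
      isSwitch-removed (isSwitch-swap isSwitch) (inj₁ (refl , refl))
                       horizontal≢vertical horizontal≢vertical
    left-edge : EdgeG V (r , j) (suc r , j)
    left-edge = matched-inV top , matched-inV bottom , neighbour⇒adj (below {r} {j})
    right-edge : EdgeG V (r , suc j) (suc r , suc j)
    right-edge =
      matched-inV (symmetric top) , matched-inV (symmetric bottom) , neighbour⇒adj (below {r} {suc j})
    s : SquareSwitch M r j
    s = record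
      { switched      = M'
      ; step          = switch-step top bottom left-edge right-edge
      ; perfect       = isSwitch-perfect pm top bottom left-edge right-edge
                          (≢-col (n<1+n j)) (≢-sym (≢-col (n<1+n j))) isSwitch
      ; hor-elsewhere = λ { (p , q) ≢top ≢bottom →
          isSwitch-unchanged isSwitch (≢top ∘ sameHorizontal⇒≡) (≢bottom ∘ sameHorizontal⇒≡)
                             horizontal≢vertical horizontal≢vertical }
      }

  horizontalise : ∀ {M r j} → PerfectMatching V M → Vertical M (r , j) → Vertical M (r , suc j) →
    Σ[ s ∈ SquareSwitch M r j ]
      (Φ (switched s) ≡ Φ M + (weight r + weight (suc r)) × Horizontal (switched s) (r , j))
  horizontalise {M} {r} {j} pm left-pair right-pair = s , (begin
      Φ M'
        ≡⟨ +-identityʳ _ ⟨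
      Φ M' + 0
        ≡⟨ cong₂ (λ x y → Φ M' + (x + y))
                 (horWeight-false {M} unmatched-top) (horWeight-false {M} unmatched-bottom) ⟨
      Φ M' + (horWeight M (r , j) + horWeight M (suc r , j))
        ≡⟨ Φ-update₂ {M} {M'} (matched-inV left-pair) (matched-inV (symmetric left-pair))
                     (≢-row (n<1+n r))
                     (hor-elsewhere s) ⟩
      Φ M + (horWeight M' (r , j) + horWeight M' (suc r , j))
        ≡⟨ cong₂ (λ x y → Φ M + (x + y))
                 (horWeight-true {M'} added-top) (horWeight-true {M'} added-bottom) ⟩
      Φ M + (weight r + weight (suc r)) ∎) , added-top
    where
    open PerfectMatchingProperties pm
    M' : EdgeRel
    M' = switch M (r , j) (suc r , j) (r , suc j) (suc r , suc j)
    isSwitch : IsSwitch M (r , j) (suc r , j) (r , suc j) (suc r , suc j) M'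
    isSwitch = switch-isSwitch M _ _ _ _
    unmatched-top : hor M (r , j) ≡ false
    unmatched-top = not-horizontal left-pair (≢-col (n<1+n j))
    unmatched-bottom : hor M (suc r , j) ≡ false
    unmatched-bottom = not-horizontal (symmetric left-pair) (≢-col (n<1+n j))
    added-top : Horizontal M' (r , j)
    added-top = from (isSwitch (r , j) (r , suc j)) (inj₂ (inj₁ (inj₁ (refl , refl))))
    added-bottom : Horizontal M' (suc r , j)
    added-bottom = from (isSwitch (suc r , j) (suc r , suc j)) (inj₂ (inj₂ (inj₁ (refl , refl))))
    top-edge : EdgeG V (r , j) (r , suc j)
    top-edge = matched-inV left-pair , matched-inV right-pair , neighbour⇒adj (right {r} {j})
    bottom-edge : EdgeG V (suc r , j) (suc r , suc j)
    bottom-edge =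
      matched-inV (symmetric left-pair) , matched-inV (symmetric right-pair) , neighbour⇒adj (right {suc r} {j})
    s : SquareSwitch M r j
    s = record
      { switched      = M'
      ; step          = switch-step left-pair right-pair top-edge bottom-edge
      ; perfect       = isSwitch-perfect pm left-pair right-pair top-edge bottom-edge
                          (≢-col (n<1+n j)) (≢-col (n<1+n j)) isSwitch
      ; hor-elsewhere = λ { (p , q) ≢top ≢bottom →
          isSwitch-unchanged isSwitch horizontal≢vertical horizontal≢vertical
                             (≢top ∘ sameHorizontal⇒≡) (≢bottom ∘ sameHorizontal⇒≡) }
      }

  Improvement : EdgeRel → Set
  Improvement M = ∃[ M' ] (Switches V M M' × PerfectMatching V M' × Φ M' < Φ M)

  improve-stacked-horizontals : ∀ {M i j} → PerfectMatching V M →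
    Horizontal M (i , j) → Horizontal M (suc i , j) → Improvement M
  improve-stacked-horizontals pm top bottom =
    let (s , Φ-eq) = verticalise pm top bottom
    in switched s , step s ◅ ε , perfect s , subst (Φ (switched s) <_) Φ-eq (m<m+n _ z<s)

  improve-horizontal-over-verticals : ∀ {M i j} → PerfectMatching V M →
    Horizontal M (i , j) → Vertical M (suc i , j) → Vertical M (suc i , suc j) → Improvement M
  improve-horizontal-over-verticals {M} {i} {j} pm top left-pair right-pair =
    let open PerfectMatchingProperties pm
        (s₁ , Φ₁ , corner) = horizontalise pm left-pair right-pair
        top₁ = trans (hor-elsewhere s₁ (i , j) (≢-row (n<1+n i)) (≢-row (m<n⇒m<1+n (n<1+n i)))) top
        (s₂ , Φ₂) = verticalise (perfect s₁) top₁ corner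
        ((_ , 2+i≤n) , _) = inGrid _ _ (matched-inV (symmetric left-pair))
    in switched s₂ , step s₁ ◅ step s₂ ◅ ε , perfect s₂ ,
       m+n≡o+p⇒p<n⇒m<o
         (trans Φ₂ (trans Φ₁ (cong (Φ M +_) (+-comm (weight (suc i)) (weight (suc (suc i)))))))
         (+-monoˡ-< _ (weight-decreasing (m<n⇒m<1+n (n<1+n i)) 2+i≤n))

  module _ {M : EdgeRel} (pm : PerfectMatching V M) where
    open PerfectMatchingProperties pm

    inV-beside-ladder : ∀ {r s t c x} k → M (r , suc c) x ≡ true → Ladder M s c k → r ≤ t → t ≤ s →
      V (t , suc c) ≡ true
    inV-beside-ladder k above-start ladder r≤t t≤s =
      let (_ , s≤b , bottom) = ladder-bottom k ladder
      in columnContinuous _ _ _ _ (matched-inV above-start) (matched-inV (symmetric bottom))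
                          r≤t (≤-trans t≤s s≤b)

    -- z = (r + 1, c + 1) is matched neither up (x ≢ z) nor left (its left neighbour is matched
    -- up); the ladder's closing edge blocks column c + 1 below, so the vertical edges below z in
    -- column c + 1 end in a horizontal edge before the ladder does.
    column-scan : ∀ k {r c x} → M (r , suc c) x ≡ true → x ≢ (suc r , suc c) → Vertical M (r , c) →
      Ladder M (suc (suc r)) c k → ∃[ m ] (m ≤ k × Ladder M (suc r) (suc c) m)
    column-scan k {r} {c} up x≢z pair ladder
      with partner (inV-beside-ladder k up ladder (n≤1+n r) (n≤1+n (suc r)))
    ... | _ , zv with neighbour zv
    ...   | right = 0 , z≤n , zv
    ...   | above = ⊥-elim (x≢z (partner-unique up (symmetric zv)))
    ...   | left  = ⊥-elim (≢-col (n<1+n c) (partner-unique (symmetric pair) (symmetric zv)))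
    ...   | below = descend k ladder zv
      where
      descend : ∀ k → Ladder M (suc (suc r)) c k → Vertical M (suc r , suc c) →
        ∃[ m ] (m ≤ k × Ladder M (suc r) (suc c) m)
      descend zero bottom zv =
        ⊥-elim (≢-col (n<1+n c) (partner-unique (symmetric bottom) (symmetric zv)))
      descend (suc k) (pair′ , ladder′) zv =
        let (m , m≤k , ladder″) =
              column-scan k (symmetric zv) (≢-row (m<n⇒m<1+n (n<1+n _))) pair′ ladder′
        in suc m , s≤s m≤k , zv , ladder″

    bracket-improvable : ∀ k {i j} → Bracket M i j k → Improvement M
    bracket-improvable = <-rec (λ k → ∀ {i j} → Bracket M i j k → Improvement M) reduce
      where
      reduce : ∀ k → (∀ {m} → m < k → ∀ {i j} → Bracket M i j m → Improvement M) →
        ∀ {i j} → Bracket M i j k → Improvement M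
      reduce zero    _       (top , bottom) = improve-stacked-horizontals pm top bottom
      reduce (suc k) smaller {i} {j} (top , pair , ladder)
        with partner (inV-beside-ladder (suc k) (symmetric top) (pair , ladder) (n≤1+n i) ≤-refl)
      ... | _ , zv with neighbour zv
      ...   | below = improve-horizontal-over-verticals pm top pair zv
      ...   | right =
        let (m , m≤k , ladder′) = column-scan k zv (≢-col (n<1+n _) ∘ sym) pair ladder
        in smaller (s≤s m≤k) (zv , ladder′)
      ...   | above = ⊥-elim (≢-col (n<1+n j) (partner-unique (symmetric top) (symmetric zv)))
      ...   | left  = ⊥-elim (≢-col (n<1+n j) (sym (partner-unique (symmetric zv) pair)))

  hasBracket-bounds : ∀ {M i j k} → PerfectMatching V M → HasBracket M i j k →
    i < suc n × j < suc n × k < suc n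
  hasBracket-bounds {i = i} {k = k} pm (top , _ , bottom) =
    let open PerfectMatchingProperties pm
        ((_ , i≤n) , (_ , j≤n)) = inGrid _ _ (matched-inV top)
        ((_ , bottom≤n) , _) = inGrid _ _ (matched-inV bottom)
        k≤bottom = ≤-trans (m≤m+n k (k + 0)) (≤-trans (m≤n+m (2 * k) i) (m≤m+n (i + 2 * k) 1))
    in s≤s i≤n , s≤s j≤n , s≤s (≤-trans k≤bottom bottom≤n)

  SomeBracket : EdgeRel → Set
  SomeBracket M = ∃ λ i → i < suc n × ∃ λ j → j < suc n × ∃ λ k → k < suc n × Bracket M i j k

  someBracket? : ∀ M → Dec (SomeBracket M)
  someBracket? M =
    anyUpTo? (λ i → anyUpTo? (λ j → anyUpTo? (λ k → bracket? M i j k) (suc n)) (suc n)) (suc n)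

  bracketFree : ∀ {M} → PerfectMatching V M → ¬ SomeBracket M → BracketFree M
  bracketFree pm none i j k hasBracket =
    let (i<N , j<N , k<N) = hasBracket-bounds pm hasBracket
    in none (i , i<N , j , j<N , k , k<N , hasBracket⇒bracket hasBracket)

  eliminate-brackets : ∀ M → PerfectMatching V M →
    ∃[ M' ] (Switches V M M' × PerfectMatching V M' × BracketFree M')
  eliminate-brackets M pm = <-rec Goal descend (Φ M) M refl pm
    where
    Goal : ℕ → Set
    Goal φ = ∀ M → Φ M ≡ φ → PerfectMatching V M →
      ∃[ M' ] (Switches V M M' × PerfectMatching V M' × BracketFree M')
    descend : ∀ φ → (∀ {ψ} → ψ < φ → Goal ψ) → Goal φ
    descend _ smaller M₀ refl pm₀ with someBracket? M₀
    ... | no none = M₀ , ε , pm₀ , bracketFree pm₀ none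
    ... | yes (_ , _ , _ , _ , k , _ , bracket) =
      let (M₁ , steps₁ , pm₁ , Φ<) = bracket-improvable pm₀ k bracket
          (M' , steps , pm' , free) = smaller Φ< M₁ refl pm₁
      in M' , steps₁ ◅◅ steps , pm' , free

mainTheorem8 : (n : ℕ) (V : VSet) → ColumnContinuousSubgrid n V →
    (M : EdgeRel) → PerfectMatching V M →
    ∃[ M' ] (Switches V M M' × PerfectMatching V M' × BracketFree M')
mainTheorem8 n V (inGrid , columnContinuous) =
  Normalisation.eliminate-brackets n V inGrid columnContinuous
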